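{- Let $h\ge 2$, let $Q$ be a set of variable indices of the balancing formula of height $h$, and let $H\subseteq\{0,\dots,h\}$ be the set of levels containing lowest common ancestors of subsets of $Q$. Conditioned on the event that neither $k$ nor $k-1$ belongs to $H$ (where $k$ is the level picked in the first step of the distribution), the distributions $D_Y$ and $D_N$ induce exactly the same distribution over the outcome of querying the variables indexed by $Q$.
   Context: The balancing formula of height $h$ is a full balanced binary tree of height $h$ whose $2^h$ leaves are variables $x_0,\dots,x_{2^h-1}$ in left-to-right order. The level of a vertex is its height above the leaves (leaves have level $0$); thus the leaves under a vertex at level $k$ are a block $x_{i2^k},\dots,x_{(i+1)2^k-1}$. Distribution $D_Y$ over $\{0,1\}^{2^h}$: pick $k$ uniformly from $\{2,\dots,h\}$; for every $0\le i<2^{h-k}$ independently pick $(y_{i,0},y_{i,1})$ to be $(0,1)$ or $(1,0)$ with probability $1/2$ each; set $x_{i2^k}=\dots=x_{i2^k+2^{k-1}-1}=y_{i,0}$ and $x_{i2^k+2^{k-1}}=\dots=x_{(i+1)2^k-1}=y_{i,1}$. Distribution $D_N$: pick $k$ uniformly from $\{2,\dots,h\}$; for every $0\le i<2^{h-k}$ independently pick $(z_{i,0},z_{i,1},z_{i,2},z_{i,3})$ uniformly among the $8$ vectors in $\{0,1\}^4$ with exactly one $1$ or exactly one $0$; set the four consecutive quarter-blocks of length $2^{k-2}$ of $x_{i2^k},\dots,x_{(i+1)2^k-1}$ to be constantly $z_{i,0},z_{i,1},z_{i,2},z_{i,3}$ respectively. -}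

module Defs where

open import Data.Nat using (ℕ; zero; suc; _+_; _*_; _∸_; _^_; _≤_; _<_)
open import Data.Nat.DivMod using (_/_; _%_)
open import Data.Nat.Properties using (m^n≢0)
open import Data.Bool using (Bool; true; false)
open import Data.Bool.Properties using () renaming (_≟_ to _≟ᵇ_)
open import Data.List using (List; []; _∷_; map; concatMap; length; filter; foldr)
open import Data.List.Properties using (≡-dec)
open import Data.List.Relation.Unary.All using (All)
open import Data.List.Membership.Propositional using (_∈_)
open import Data.Fin using (Fin; toℕ)
open import Data.Product using (Σ; ∃; _×_; _,_)
open import Relation.Binary.PropositionalEquality using (_≡_)
open import Relation.Nullary using (¬_)
open import Data.Integer using (+_)
open import Data.Rational using (ℚ; 0ℚ) renaming (_+_ to _+ℚ_; _*_ to _*ℚ_)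
import Data.Rational as ℚ

-- The vertex at level ℓ with index j has as leaves the block
-- x_{j 2^ℓ}, ..., x_{(j+1) 2^ℓ - 1}; so leaf i lies below vertex (ℓ , i / 2^ℓ).

blockOf : (ℓ i : ℕ) → ℕ
blockOf ℓ i = _/_ i (2 ^ ℓ) {{m^n≢0 2 ℓ}}

offsetIn : (ℓ i : ℕ) → ℕ
offsetIn ℓ i = _%_ i (2 ^ ℓ) {{m^n≢0 2 ℓ}}

Below : ℕ → ℕ → List ℕ → Set
Below ℓ j S = All (λ i → blockOf ℓ i ≡ j) S

IsLCA : ℕ → ℕ → List ℕ → Set
IsLCA ℓ j S = Below ℓ j S × (∀ ℓ′ j′ → ℓ′ < ℓ → ¬ Below ℓ′ j′ S)

NonEmpty : {A : Set} → List A → Set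
NonEmpty xs = ∃ λ y → y ∈ xs

InH : (h : ℕ) → List (Fin (2 ^ h)) → ℕ → Set
InH h Q ℓ = Σ (List (Fin (2 ^ h))) λ S →
  NonEmpty S × All (λ i → i ∈ Q) S × ∃ λ j → IsLCA ℓ j (map toℕ S)

seqs : {A : Set} → List A → ℕ → List (List A)
seqs xs zero = [] ∷ []
seqs xs (suc m) = concatMap (λ x → map (x ∷_) (seqs xs m)) xs

nth : List Bool → ℕ → Bool
nth [] _ = false
nth (b ∷ bs) zero = b
nth (b ∷ bs) (suc n) = nth bs n

nthL : List (List Bool) → ℕ → List Bool
nthL [] _ = []
nthL (b ∷ bs) zero = b
nthL (b ∷ bs) (suc n) = nthL bs n

pairsY : List (List Bool)
pairsY = (false ∷ true ∷ []) ∷ (true ∷ false ∷ []) ∷ []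

quadsN : List (List Bool)
quadsN =
    (true ∷ false ∷ false ∷ false ∷ [])
  ∷ (false ∷ true ∷ false ∷ false ∷ [])
  ∷ (false ∷ false ∷ true ∷ false ∷ [])
  ∷ (false ∷ false ∷ false ∷ true ∷ [])
  ∷ (false ∷ true ∷ true ∷ true ∷ [])
  ∷ (true ∷ false ∷ true ∷ true ∷ [])
  ∷ (true ∷ true ∷ false ∷ true ∷ [])
  ∷ (true ∷ true ∷ true ∷ false ∷ [])
  ∷ []

-- choice sequences (one entry per block 0 ≤ i < 2^(h-k)), all equally likely
choicesY choicesN : (h k : ℕ) → List (List (List Bool))
choicesY h k = seqs pairsY (2 ^ (h ∸ k))
choicesN h k = seqs quadsN (2 ^ (h ∸ k))

-- value of leaf i given level k and choice c
-- D_Y: block of length 2^k, halves of length 2^(k-1)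
leafY : (k : ℕ) → List (List Bool) → ℕ → Bool
leafY k c i = nth (nthL c (blockOf k i)) (_/_ (offsetIn k i) (2 ^ (k ∸ 1)) {{m^n≢0 2 (k ∸ 1)}})

-- D_N: block of length 2^k, quarters of length 2^(k-2)
leafN : (k : ℕ) → List (List Bool) → ℕ → Bool
leafN k c i = nth (nthL c (blockOf k i)) (_/_ (offsetIn k i) (2 ^ (k ∸ 2)) {{m^n≢0 2 (k ∸ 2)}})

query : {h : ℕ} → (ℕ → Bool) → List (Fin (2 ^ h)) → List Bool
query x Q = map (λ i → x (toℕ i)) Q

frac : ℕ → ℕ → ℚ
frac n zero = 0ℚ
frac n (suc d) = (+ n) ℚ./ suc d

probAmong : List (List (List Bool)) → (List (List Bool) → List Bool) → List Bool → ℚ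
probAmong cs out a = frac (length (filter (λ c → ≡-dec _≟ᵇ_ (out c) a) cs)) (length cs)

-- Pr[ k = k₀ and outcome = a ] for D_Y / D_N (k uniform on {2..h}, h-1 values)
jointY jointN : (h : ℕ) → List (Fin (2 ^ h)) → ℕ → List Bool → ℚ
jointY h Q k a = frac 1 (h ∸ 1) *ℚ probAmong (choicesY h k) (λ c → query {h} (leafY k c) Q) a
jointN h Q k a = frac 1 (h ∸ 1) *ℚ probAmong (choicesN h k) (λ c → query {h} (leafN k c) Q) a

sumℚ : List ℚ → ℚ
sumℚ = foldr _+ℚ_ 0ℚ

eventY eventN : (h : ℕ) → List (Fin (2 ^ h)) → List ℕ → List Bool → ℚ
eventY h Q K a = sumℚ (map (λ k → jointY h Q k a) K)
eventN h Q K a = sumℚ (map (λ k → jointN h Q k a) K)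

-- Fix an admissible level k+2. Two queried leaves in a common level-(k+2) block must lie in a
-- common level-k block (else their LCA is at level k+2 or k+1), so all queried leaves of a
-- block b lie in one quarter ρ(b) of it. Hence the query outcome is a fixed function of the
-- list of "observed" values: coordinate ρ(b) of the D_N quadruple of block b, resp.
-- coordinate ⌊ρ(b)/2⌋ of the D_Y pair. Each coordinate of a quadruple takes each Boolean value
-- in 4 of the 8 quadruples, as the corresponding pair coordinate does in 1 of 2 pairs.

module Submission where

open import Defs
open import Data.Nat using (ℕ; _≤_; _∸_; _^_)
open import Data.Bool using (Bool)
open import Data.Fin using (Fin)
open import Data.List using (List)
open import Data.List.Membership.Propositional using (_∈_)
open import Data.List.Relation.Unary.Unique.Propositional using (Unique)
open import Data.Product using (_×_)
open import Relation.Binary.PropositionalEquality using (_≡_)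
open import Relation.Nullary using (¬_)
open import Function.Bundles using (_⇔_)

open import Data.Nat using (zero; suc; _+_; _*_; _<_; z≤n; s≤s; NonZero)
open import Data.Nat.Properties
open import Data.Nat.DivMod using (_/_; _%_; /-congˡ; /-congʳ; %-congʳ; m/n/o≡m/[n*o]; m%[n*o]/o≡m/o%n; m%n<n)
open import Data.Nat.Tactic.RingSolver using (solve-∀)
open import Data.Bool using (true; false; if_then_else_)
open import Data.Bool.Properties using () renaming (_≟_ to _≟ᵇ_)
open import Data.List using ([]; _∷_; map; concatMap; length; filter; _++_)
open import Data.List.Properties using (≡-dec; map-cong-local)
open import Data.List.Relation.Unary.All using ([]; _∷_; tabulate)
open import Data.List.Relation.Unary.Any using (here; there)
open import Data.Fin using (toℕ)
open import Data.Product using (_,_)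
open import Relation.Binary.PropositionalEquality using (refl; sym; trans; cong; cong₂; subst; _≢_; module ≡-Reasoning)
open import Relation.Nullary using (does; yes; no)
open import Data.Empty using (⊥-elim)
open import Relation.Unary using (Decidable)
open import Function using (_∘_)
open import Function.Bundles using (Equivalence)
import Data.Integer as ℤ
import Data.Integer.Properties as ℤ
open import Data.Rational using () renaming (_*_ to _*ℚ_)
open import Data.Rational.Properties using (fromℚᵘ-cong)
import Data.Rational.Unnormalised as ℚᵘ

-- total weight of a list; counting is weighing with indicators, so all counting in the
-- proof is done with `weight`
weight : {A : Set} → (A → ℕ) → List A → ℕ
weight w [] = 0
weight w (x ∷ xs) = w x + weight w xs

weight-++ : {A : Set} (w : A → ℕ) (xs ys : List A) → weight w (xs ++ ys) ≡ weight w xs + weight w ys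
weight-++ w [] ys = refl
weight-++ w (x ∷ xs) ys = trans (cong (w x +_) (weight-++ w xs ys)) (sym (+-assoc (w x) _ _))

weight-map : {A B : Set} (w : B → ℕ) (f : A → B) (xs : List A) → weight w (map f xs) ≡ weight (w ∘ f) xs
weight-map w f [] = refl
weight-map w f (x ∷ xs) = cong (w (f x) +_) (weight-map w f xs)

weight-cong : {A : Set} {w w′ : A → ℕ} → (∀ x → w x ≡ w′ x) → (xs : List A) → weight w xs ≡ weight w′ xs
weight-cong e [] = refl
weight-cong e (x ∷ xs) = cong₂ _+_ (e x) (weight-cong e xs)

weight-*ˡ : {A : Set} (k : ℕ) (w : A → ℕ) (xs : List A) → weight (λ x → k * w x) xs ≡ k * weight w xs
weight-*ˡ k w [] = sym (*-zeroʳ k)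
weight-*ˡ k w (x ∷ xs) = trans (cong (k * w x +_) (weight-*ˡ k w xs)) (sym (*-distribˡ-+ k (w x) _))

length-weight : {A : Set} (xs : List A) → length xs ≡ weight (λ _ → 1) xs
length-weight [] = refl
length-weight (x ∷ xs) = cong suc (length-weight xs)

length-filter : {A : Set} {P : A → Set} (P? : Decidable P) (xs : List A) →
  length (filter P? xs) ≡ weight (λ x → if does (P? x) then 1 else 0) xs
length-filter P? [] = refl
length-filter P? (x ∷ xs) with does (P? x)
... | true = cong suc (length-filter P? xs)
... | false = length-filter P? xs

weight-seqs-suc : {A : Set} (w : List A → ℕ) (xs : List A) (m : ℕ) →
  weight w (seqs xs (suc m)) ≡ weight (λ x → weight (w ∘ (x ∷_)) (seqs xs m)) xs
weight-seqs-suc w xs m = prefixes xs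
  where
  prefixes : ∀ ys → weight w (concatMap (λ x → map (x ∷_) (seqs xs m)) ys)
                    ≡ weight (λ x → weight (w ∘ (x ∷_)) (seqs xs m)) ys
  prefixes [] = refl
  prefixes (y ∷ ys) = begin
      weight w (map (y ∷_) (seqs xs m) ++ concatMap (λ x → map (x ∷_) (seqs xs m)) ys)
    ≡⟨ weight-++ w (map (y ∷_) (seqs xs m)) _ ⟩
      weight w (map (y ∷_) (seqs xs m)) + weight w (concatMap (λ x → map (x ∷_) (seqs xs m)) ys)
    ≡⟨ cong₂ _+_ (weight-map w (y ∷_) (seqs xs m)) (prefixes ys) ⟩
      weight (w ∘ (y ∷_)) (seqs xs m) + weight (λ x → weight (w ∘ (x ∷_)) (seqs xs m)) ys
    ∎
    where open ≡-Reasoning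

-- `f` maps the (uniform) list `xs` onto `s` copies of what `g` maps `ys` onto:
-- every weight on the common codomain has s times the total along `f` as along `g`.
ScaledImage : {A B C : Set} → ℕ → List A → (A → B) → List C → (C → B) → Set
ScaledImage {B = B} s xs f ys g = (w : B → ℕ) → weight (w ∘ f) xs ≡ s * weight (w ∘ g) ys

readAll : {A B : Set} → (ℕ → A → B) → List A → List B
readAll F [] = []
readAll F (x ∷ c) = F 0 x ∷ readAll (F ∘ suc) c

readAll-scaled : {A B C : Set} (s : ℕ) (xs : List A) (ys : List C) (F : ℕ → A → B) (G : ℕ → C → B) →
  (∀ b → ScaledImage s xs (F b) ys (G b)) →
  ∀ m → ScaledImage (s ^ m) (seqs xs m) (readAll F) (seqs ys m) (readAll G)
readAll-scaled s xs ys F G scaled zero w = sym (+-identityʳ _)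
readAll-scaled {B = B} s xs ys F G scaled (suc m) w = begin
    weight (w ∘ readAll F) (seqs xs (suc m))
  ≡⟨ weight-seqs-suc (w ∘ readAll F) xs m ⟩
    weight (λ x → weight (λ c → w (F 0 x ∷ readAll (F ∘ suc) c)) (seqs xs m)) xs
  ≡⟨ weight-cong (λ x → readAll-scaled s xs ys (F ∘ suc) (G ∘ suc) (scaled ∘ suc) m (w ∘ (F 0 x ∷_))) xs ⟩
    weight (tail ∘ F 0) xs
  ≡⟨ scaled 0 tail ⟩
    s * weight (tail ∘ G 0) ys
  ≡⟨ cong (s *_) (weight-*ˡ (s ^ m) (λ y → weight (λ c → w (G 0 y ∷ readAll (G ∘ suc) c)) (seqs ys m)) ys) ⟩
    s * (s ^ m * weight (λ y → weight (λ c → w (G 0 y ∷ readAll (G ∘ suc) c)) (seqs ys m)) ys)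
  ≡⟨ sym (*-assoc s (s ^ m) _) ⟩
    s ^ suc m * weight (λ y → weight (λ c → w (G 0 y ∷ readAll (G ∘ suc) c)) (seqs ys m)) ys
  ≡⟨ cong (s ^ suc m *_) (sym (weight-seqs-suc (w ∘ readAll G) ys m)) ⟩
    s ^ suc m * weight (w ∘ readAll G) (seqs ys (suc m))
  ∎
  where
  open ≡-Reasoning
  tail : B → ℕ
  tail v = s ^ m * weight (λ c → w (v ∷ readAll (G ∘ suc) c)) (seqs ys m)

frac-scale : ∀ s n d → 0 < s → frac (s * n) (s * d) ≡ frac n d
frac-scale (suc s) n zero _ rewrite *-zeroʳ s = refl
frac-scale (suc s) n (suc d) _ =
  fromℚᵘ-cong {ℚᵘ.mkℚᵘ (ℤ.+ (suc s * n)) (d + s * suc d)} {ℚᵘ.mkℚᵘ (ℤ.+ n) d} (ℚᵘ.*≡* cross)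
  where
  rearrange : ∀ x y z → x * y * z ≡ y * (x * z)
  rearrange = solve-∀
  cross : ℤ.+ (suc s * n) ℤ.* ℤ.+ suc d ≡ ℤ.+ n ℤ.* ℤ.+ (suc s * suc d)
  cross = begin
      ℤ.+ (suc s * n) ℤ.* ℤ.+ suc d  ≡⟨ sym (ℤ.pos-* (suc s * n) (suc d)) ⟩
      ℤ.+ (suc s * n * suc d)        ≡⟨ cong ℤ.+_ (rearrange (suc s) n (suc d)) ⟩
      ℤ.+ (n * (suc s * suc d))      ≡⟨ ℤ.pos-* n (suc s * suc d) ⟩
      ℤ.+ n ℤ.* ℤ.+ (suc s * suc d)  ∎
    where open ≡-Reasoning

probAmong-scaled : {B : Set} (s : ℕ) → 0 < s →
  (cs ds : List (List (List Bool))) (F : List (List Bool) → B) (G : List (List Bool) → B) →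
  ScaledImage s cs F ds G →
  (o : B → List Bool) (outF outG : List (List Bool) → List Bool) →
  (∀ c → outF c ≡ o (F c)) → (∀ d → outG d ≡ o (G d)) →
  ∀ a → probAmong ds outG a ≡ probAmong cs outF a
probAmong-scaled {B} s s>0 cs ds F G scaled o outF outG viaF viaG a = begin
    frac (hits outG ds) (length ds)
  ≡⟨ sym (frac-scale s (hits outG ds) (length ds) s>0) ⟩
    frac (s * hits outG ds) (s * length ds)
  ≡⟨ cong₂ frac (sym hitsScale) (sym lengthScale) ⟩
    frac (hits outF cs) (length cs)
  ∎
  where
  open ≡-Reasoning
  hits : (List (List Bool) → List Bool) → List (List (List Bool)) → ℕ
  hits out xs = length (filter (λ c → ≡-dec _≟ᵇ_ (out c) a) xs)
  hit : List Bool → ℕ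
  hit v = if does (≡-dec _≟ᵇ_ v a) then 1 else 0
  hits-via : ∀ out (H : List (List Bool) → B) → (∀ c → out c ≡ o (H c)) → ∀ xs → hits out xs ≡ weight (hit ∘ o ∘ H) xs
  hits-via out H via xs = trans (length-filter (λ c → ≡-dec _≟ᵇ_ (out c) a) xs) (weight-cong (cong hit ∘ via) xs)
  hitsScale : hits outF cs ≡ s * hits outG ds
  hitsScale = begin
      hits outF cs                  ≡⟨ hits-via outF F viaF cs ⟩
      weight (hit ∘ o ∘ F) cs       ≡⟨ scaled (hit ∘ o) ⟩
      s * weight (hit ∘ o ∘ G) ds   ≡⟨ cong (s *_) (sym (hits-via outG G viaG ds)) ⟩
      s * hits outG ds              ∎
  lengthScale : length cs ≡ s * length ds
  lengthScale = begin
      length cs                     ≡⟨ length-weight cs ⟩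
      weight (λ _ → 1) cs           ≡⟨ scaled (λ _ → 1) ⟩
      s * weight (λ _ → 1) ds       ≡⟨ cong (s *_) (sym (length-weight ds)) ⟩
      s * length ds                 ∎

occurrences : Bool → List Bool → ℕ
occurrences v = weight (λ b → if does (b ≟ᵇ v) then 1 else 0)

weight-Bool : (w : Bool → ℕ) (bs : List Bool) →
  weight w bs ≡ occurrences true bs * w true + occurrences false bs * w false
weight-Bool w [] = refl
weight-Bool w (true ∷ bs) =
  trans (cong (w true +_) (weight-Bool w bs)) (sym (+-assoc (w true) _ _))
weight-Bool w (false ∷ bs) =
  trans (cong (w false +_) (weight-Bool w bs))
        (swap (w false) (occurrences true bs * w true) (occurrences false bs * w false))
  where
  swap : ∀ x y z → x + (y + z) ≡ y + (x + z)
  swap = solve-∀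

bool-scaled : {A C : Set} (s : ℕ) (xs : List A) (f : A → Bool) (ys : List C) (g : C → Bool) →
  (∀ v → occurrences v (map f xs) ≡ s * occurrences v (map g ys)) → ScaledImage s xs f ys g
bool-scaled s xs f ys g counts w = begin
    weight (w ∘ f) xs
  ≡⟨ sym (weight-map w f xs) ⟩
    weight w (map f xs)
  ≡⟨ weight-Bool w (map f xs) ⟩
    occurrences true (map f xs) * w true + occurrences false (map f xs) * w false
  ≡⟨ cong₂ (λ t u → t * w true + u * w false) (counts true) (counts false) ⟩
    s * occurrences true (map g ys) * w true + s * occurrences false (map g ys) * w false
  ≡⟨ factor s (occurrences true (map g ys)) (w true) (occurrences false (map g ys)) (w false) ⟩
    s * (occurrences true (map g ys) * w true + occurrences false (map g ys) * w false)
  ≡⟨ cong (s *_) (sym (weight-Bool w (map g ys))) ⟩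
    s * weight w (map g ys)
  ≡⟨ cong (s *_) (weight-map w g ys) ⟩
    s * weight (w ∘ g) ys
  ∎
  where
  open ≡-Reasoning
  factor : ∀ s a x b y → s * a * x + s * b * y ≡ s * (a * x + b * y)
  factor = solve-∀

quarter-balanced : ∀ r → r < 4 → ∀ v →
  occurrences v (map (λ z → nth z r) quadsN) ≡ 4 * occurrences v (map (λ y → nth y (r / 2)) pairsY)
quarter-balanced 0 _ true = refl
quarter-balanced 0 _ false = refl
quarter-balanced 1 _ true = refl
quarter-balanced 1 _ false = refl
quarter-balanced 2 _ true = refl
quarter-balanced 2 _ false = refl
quarter-balanced 3 _ true = refl
quarter-balanced 3 _ false = refl
quarter-balanced (suc (suc (suc (suc r)))) (s≤s (s≤s (s≤s (s≤s ())))) _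

nth-readAll : (pos : ℕ → ℕ) (c : List (List Bool)) (b : ℕ) →
  nth (readAll (λ b z → nth z (pos b)) c) b ≡ nth (nthL c b) (pos b)
nth-readAll pos [] b = refl
nth-readAll pos (x ∷ c) zero = refl
nth-readAll pos (x ∷ c) (suc b) = nth-readAll (pos ∘ suc) c b

lookupBy : {A : Set} → (A → ℕ) → (A → ℕ) → List A → ℕ → ℕ
lookupBy key val [] b = 0
lookupBy key val (x ∷ xs) b with key x ≟ b
... | yes _ = val x
... | no _ = lookupBy key val xs b

lookupBy-factors : {A : Set} (key val : A → ℕ) (xs : List A) →
  (∀ {x y} → x ∈ xs → y ∈ xs → key x ≡ key y → val x ≡ val y) →
  ∀ {x} → x ∈ xs → lookupBy key val xs (key x) ≡ val x
lookupBy-factors key val (y ∷ ys) coherent {x} x∈ with key y ≟ key x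
... | yes same = coherent (here refl) x∈ same
... | no differ with x∈
...   | here refl = ⊥-elim (differ refl)
...   | there x∈ys = lookupBy-factors key val ys (λ p q → coherent (there p) (there q)) x∈ys

lookupBy-< : {A : Set} (key val : A → ℕ) (xs : List A) {n : ℕ} → 0 < n → (∀ x → val x < n) →
  ∀ b → lookupBy key val xs b < n
lookupBy-< key val [] n>0 val< b = n>0
lookupBy-< key val (x ∷ xs) n>0 val< b with key x ≟ b
... | yes _ = val< x
... | no _ = lookupBy-< key val xs n>0 val< b

blockOf-+ : ∀ ℓ d x → blockOf (ℓ + d) x ≡ blockOf d (blockOf ℓ x)
blockOf-+ ℓ d x = trans
  (/-congʳ {{m^n≢0 2 (ℓ + d)}} {{2^ℓ*2^d≢0}} (^-distribˡ-+-* 2 ℓ d))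
  (sym (m/n/o≡m/[n*o] x (2 ^ ℓ) (2 ^ d) {{m^n≢0 2 ℓ}} {{m^n≢0 2 d}} {{2^ℓ*2^d≢0}}))
  where
  2^ℓ*2^d≢0 : NonZero (2 ^ ℓ * 2 ^ d)
  2^ℓ*2^d≢0 = m*n≢0 (2 ^ ℓ) (2 ^ d) {{m^n≢0 2 ℓ}} {{m^n≢0 2 d}}

blockOf-mono : ∀ {ℓ L} x y → ℓ ≤ L → blockOf ℓ x ≡ blockOf ℓ y → blockOf L x ≡ blockOf L y
blockOf-mono {ℓ} {L} x y ℓ≤L same = subst (λ n → blockOf n x ≡ blockOf n y) (m+[n∸m]≡n ℓ≤L) (begin
    blockOf (ℓ + (L ∸ ℓ)) x          ≡⟨ blockOf-+ ℓ (L ∸ ℓ) x ⟩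
    blockOf (L ∸ ℓ) (blockOf ℓ x)    ≡⟨ cong (blockOf (L ∸ ℓ)) same ⟩
    blockOf (L ∸ ℓ) (blockOf ℓ y)    ≡⟨ sym (blockOf-+ ℓ (L ∸ ℓ) y) ⟩
    blockOf (ℓ + (L ∸ ℓ)) y          ∎)
  where open ≡-Reasoning

split⇒InH : ∀ h (Q : List (Fin (2 ^ h))) {i j : Fin (2 ^ h)} → i ∈ Q → j ∈ Q → ∀ ℓ →
  blockOf (suc ℓ) (toℕ i) ≡ blockOf (suc ℓ) (toℕ j) → blockOf ℓ (toℕ i) ≢ blockOf ℓ (toℕ j) →
  InH h Q (suc ℓ)
split⇒InH h Q {i} {j} i∈Q j∈Q ℓ together apart =
  (i ∷ j ∷ []) , (i , here refl) , (i∈Q ∷ j∈Q ∷ []) , blockOf (suc ℓ) (toℕ i) ,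
  (refl ∷ sym together ∷ []) , notLower
  where
  notLower : ∀ ℓ′ j′ → ℓ′ < suc ℓ → ¬ Below ℓ′ j′ (toℕ i ∷ toℕ j ∷ [])
  notLower ℓ′ j′ (s≤s ℓ′≤ℓ) (i∈ ∷ j∈ ∷ []) = apart (blockOf-mono (toℕ i) (toℕ j) ℓ′≤ℓ (trans i∈ (sym j∈)))

sameQuarterBlock : ∀ h (Q : List (Fin (2 ^ h))) k → ¬ InH h Q (2 + k) → ¬ InH h Q (1 + k) →
  ∀ {i j} → i ∈ Q → j ∈ Q →
  blockOf (2 + k) (toℕ i) ≡ blockOf (2 + k) (toℕ j) → blockOf k (toℕ i) ≡ blockOf k (toℕ j)
sameQuarterBlock h Q k ∉H₂ ∉H₁ {i} {j} i∈Q j∈Q together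
  with blockOf (1 + k) (toℕ i) ≟ blockOf (1 + k) (toℕ j)
... | no apart₁ = ⊥-elim (∉H₂ (split⇒InH h Q i∈Q j∈Q (1 + k) together apart₁))
... | yes together₁ with blockOf k (toℕ i) ≟ blockOf k (toℕ j)
...   | yes together₀ = together₀
...   | no apart₀ = ⊥-elim (∉H₁ (split⇒InH h Q i∈Q j∈Q k together₁ apart₀))

-- the quarter (0..3) of its level-(k+2) block in which leaf x lies; this is the
-- coordinate of the D_N quadruple that x reads
quarterIn : ℕ → ℕ → ℕ
quarterIn k x = _/_ (offsetIn (2 + k) x) (2 ^ k) {{m^n≢0 2 k}}

quarterIn-mod : ∀ k x → quarterIn k x ≡ blockOf k x % 4
quarterIn-mod k x = trans
  (/-congˡ {{m^n≢0 2 k}} (%-congʳ {{m^n≢0 2 (2 + k)}} {{4*2^k≢0}} (^-distribˡ-+-* 2 2 k)))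
  (m%[n*o]/o≡m/o%n x 4 (2 ^ k) {{_}} {{m^n≢0 2 k}} {{4*2^k≢0}})
  where
  4*2^k≢0 : NonZero (4 * 2 ^ k)
  4*2^k≢0 = m*n≢0 4 (2 ^ k) {{_}} {{m^n≢0 2 k}}

quarterIn<4 : ∀ k x → quarterIn k x < 4
quarterIn<4 k x = subst (_< 4) (sym (quarterIn-mod k x)) (m%n<n (blockOf k x) 4)

-- the half of its level-(k+2) block in which leaf x lies (the coordinate of the D_Y pair
-- that x reads) is the quarter halved
halfIn : ∀ k x → _/_ (offsetIn (2 + k) x) (2 ^ (1 + k)) {{m^n≢0 2 (1 + k)}} ≡ quarterIn k x / 2
halfIn k x = sym (trans
  (m/n/o≡m/[n*o] (offsetIn (2 + k) x) (2 ^ k) 2 {{m^n≢0 2 k}} {{_}} {{2^k*2≢0}})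
  (/-congʳ {{2^k*2≢0}} {{m^n≢0 2 (1 + k)}} (*-comm (2 ^ k) 2)))
  where
  2^k*2≢0 : NonZero (2 ^ k * 2)
  2^k*2≢0 = m*n≢0 (2 ^ k) 2 {{m^n≢0 2 k}} {{_}}

level-indistinguishable : ∀ h (Q : List (Fin (2 ^ h))) k → ¬ InH h Q (2 + k) → ¬ InH h Q (1 + k) →
  ∀ a → probAmong (choicesY h (2 + k)) (λ c → query {h} (leafY (2 + k) c) Q) a
      ≡ probAmong (choicesN h (2 + k)) (λ c → query {h} (leafN (2 + k) c) Q) a
level-indistinguishable h Q k ∉H₂ ∉H₁ =
  probAmong-scaled (4 ^ M) (m^n>0 4 M) (seqs quadsN M) (seqs pairsY M)
    (readAll quarterAt) (readAll halfAt) (readAll-scaled 4 quadsN pairsY quarterAt halfAt blockScaled M)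
    observe (λ c → query {h} (leafN (2 + k) c) Q) (λ c → query {h} (leafY (2 + k) c) Q) viaN viaY
  where
  M : ℕ
  M = 2 ^ (h ∸ (2 + k))
  block : Fin (2 ^ h) → ℕ
  block i = blockOf (2 + k) (toℕ i)
  -- the common quarter of the queried leaves in block b
  ρ : ℕ → ℕ
  ρ = lookupBy block (quarterIn k ∘ toℕ) Q
  ρ-spec : ∀ {i} → i ∈ Q → ρ (block i) ≡ quarterIn k (toℕ i)
  ρ-spec = lookupBy-factors block (quarterIn k ∘ toℕ) Q λ {i} {j} i∈Q j∈Q same → begin
      quarterIn k (toℕ i)     ≡⟨ quarterIn-mod k (toℕ i) ⟩
      blockOf k (toℕ i) % 4   ≡⟨ cong (_% 4) (sameQuarterBlock h Q k ∉H₂ ∉H₁ i∈Q j∈Q same) ⟩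
      blockOf k (toℕ j) % 4   ≡⟨ sym (quarterIn-mod k (toℕ j)) ⟩
      quarterIn k (toℕ j)     ∎
    where open ≡-Reasoning
  quarterAt halfAt : ℕ → List Bool → Bool
  quarterAt b z = nth z (ρ b)
  halfAt b y = nth y (ρ b / 2)
  blockScaled : ∀ b → ScaledImage 4 quadsN (quarterAt b) pairsY (halfAt b)
  blockScaled b = bool-scaled 4 quadsN (quarterAt b) pairsY (halfAt b)
    (quarter-balanced (ρ b) (lookupBy-< block (quarterIn k ∘ toℕ) Q (s≤s z≤n) (quarterIn<4 k ∘ toℕ) b))
  observe : List Bool → List Bool
  observe v = map (λ i → nth v (block i)) Q
  viaN : ∀ c → query {h} (leafN (2 + k) c) Q ≡ observe (readAll quarterAt c)
  viaN c = map-cong-local (tabulate λ {i} i∈Q → begin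
      nth (nthL c (block i)) (quarterIn k (toℕ i))  ≡⟨ cong (nth (nthL c (block i))) (sym (ρ-spec i∈Q)) ⟩
      nth (nthL c (block i)) (ρ (block i))          ≡⟨ sym (nth-readAll ρ c (block i)) ⟩
      nth (readAll quarterAt c) (block i)           ∎)
    where open ≡-Reasoning
  viaY : ∀ c → query {h} (leafY (2 + k) c) Q ≡ observe (readAll halfAt c)
  viaY c = map-cong-local (tabulate λ {i} i∈Q → begin
      nth (nthL c (block i)) (_/_ (offsetIn (2 + k) (toℕ i)) (2 ^ (1 + k)) {{m^n≢0 2 (1 + k)}})
        ≡⟨ cong (nth (nthL c (block i))) (halfIn k (toℕ i)) ⟩
      nth (nthL c (block i)) (quarterIn k (toℕ i) / 2)
        ≡⟨ cong (λ r → nth (nthL c (block i)) (r / 2)) (sym (ρ-spec i∈Q)) ⟩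
      nth (nthL c (block i)) (ρ (block i) / 2)
        ≡⟨ sym (nth-readAll (λ b → ρ b / 2) c (block i)) ⟩
      nth (readAll halfAt c) (block i)
        ∎)
    where open ≡-Reasoning

lemma7p5 : (h : ℕ) → 2 ≤ h → (Q : List (Fin (2 ^ h))) →
    (K : List ℕ) → Unique K →
    (∀ k → (k ∈ K) ⇔ ((2 ≤ k × k ≤ h) × (¬ InH h Q k × ¬ InH h Q (k ∸ 1)))) →
    (a : List Bool) → eventY h Q K a ≡ eventN h Q K a
lemma7p5 h _ Q K _ K-spec a = cong sumℚ (map-cong-local (tabulate sameJoint))
  where
  sameJoint : ∀ {k} → k ∈ K → jointY h Q k a ≡ jointN h Q k a
  sameJoint {k} k∈K with Equivalence.to (K-spec k) k∈K
  ... | (2≤k , _) , ∉H₀ , ∉H₁ = atLevel 2≤k ∉H₀ ∉H₁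
    where
    atLevel : ∀ {k} → 2 ≤ k → ¬ InH h Q k → ¬ InH h Q (k ∸ 1) → jointY h Q k a ≡ jointN h Q k a
    atLevel {suc (suc k)} (s≤s (s≤s _)) ∉H₀ ∉H₁ =
      cong (frac 1 (h ∸ 1) *ℚ_) (level-indistinguishable h Q k ∉H₀ ∉H₁ a)
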